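{- For $n\ge1$ and $k\ge0$ let $U_k(n)$ be the set of binary words $w\in\{0,1\}^n$ with $\mathrm{des}(\mathrm{runsort}(w))=k$. Then $U_0(n)$ consists exactly of the binary words of length $n$ of the form $1^a0^d$ with $a,d\ge0$, or of the form $1^a0^b1^c0^d$ with $a,d\ge0$, $b,c\ge1$. Moreover, for every $k\ge2$, $U_{k-1}(n)$ consists exactly of the binary words of length $n$ of the form \[ 1^a\,0^{b_1}1^{c_1}\,0^{b_2}1^{c_2}\dotsm 0^{b_k}1^{c_k}\,0^d,\qquad a,d\ge0,\ b_i,c_i\ge1 . \]
   Context: For a word $w=w(1)\dotsm w(n)$ over $\{0,1\}$, $k\in[n-1]$ is a descent if $w(k)>w(k+1)$ and $\mathrm{des}(w)$ is the number of descents. The runs of $w$ are its maximal weakly increasing contiguous subwords. $\mathrm{runsort}(w)$ is the word obtained by rearranging the runs of $w$ in lexicographic order (e.g. $\mathrm{runsort}(1\,011\,0111\,00011)=00011\,011\,0111\,1$). $x^m$ denotes $m$ consecutive copies of the letter $x$. -}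

module Defs where

open import Data.Bool using (Bool; true; false; if_then_else_)
open import Data.Nat using (ℕ; zero; suc; _+_)
open import Data.List using (List; []; _∷_; _++_; replicate; concat)
open import Data.Vec using (Vec; []; _∷_)
open import Data.Product using (_×_; _,_)

-- Binary words: letters 0 = false, 1 = true.
Word : Set
Word = List Bool

_^^_ : Bool → ℕ → Word
x ^^ m = replicate m x

isDesc : Bool → Bool → Bool
isDesc true false = true
isDesc _    _     = false

des : Word → ℕ
des [] = 0
des (x ∷ []) = 0
des (x ∷ y ∷ ys) = (if isDesc x y then 1 else 0) + des (y ∷ ys)

-- runs of x ∷ xs : (first run, remaining runs); a new run starts exactly after a descent
runsAux : Bool → Word → Word × List Word
runsAux x [] = (x ∷ [] , [])
runsAux x (y ∷ ys) with runsAux y ys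
... | (r , rs) = if isDesc x y then (x ∷ [] , r ∷ rs) else (x ∷ r , rs)

runs : Word → List Word
runs [] = []
runs (x ∷ xs) with runsAux x xs
... | (r , rs) = r ∷ rs

lexLeq : Word → Word → Bool
lexLeq [] _ = true
lexLeq (_ ∷ _) [] = false
lexLeq (false ∷ xs) (true ∷ ys) = true
lexLeq (true ∷ xs) (false ∷ ys) = false
lexLeq (false ∷ xs) (false ∷ ys) = lexLeq xs ys
lexLeq (true ∷ xs) (true ∷ ys) = lexLeq xs ys

insertLex : Word → List Word → List Word
insertLex u [] = u ∷ []
insertLex u (v ∷ vs) = if lexLeq u v then u ∷ v ∷ vs else v ∷ insertLex u vs

sortLex : List Word → List Word
sortLex [] = []
sortLex (u ∷ us) = insertLex u (sortLex us)

runsort : Word → Word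
runsort w = concat (sortLex (runs w))

blocks : ∀ {k} → Vec ℕ k → Vec ℕ k → Word
blocks [] [] = []
blocks (b ∷ bs) (c ∷ cs) = (false ^^ b) ++ (true ^^ c) ++ blocks bs cs

-- Every binary word factors uniquely as 1^a (0^{b₁}1^{c₁}) ⋯ (0^{bₘ}1^{cₘ}) 0^d with all bᵢ, cᵢ ≥ 1,
-- and its runs are exactly the nonempty factors 1^a, 0^{bᵢ}1^{cᵢ}, 0^d.  In lexicographic order 0^d
-- comes first and 1^a last, with the blocks 0^{bᵢ}1^{cᵢ} in between in some order.  Each block begins
-- with 0 and ends with 1, so runsort w has exactly one descent between consecutive blocks and no other:
-- des (runsort w) = m ∸ 1.  The two parts of the theorem are the cases m ≤ 1 and m = k ≥ 2.
module Submission where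

open import Defs
open import Data.Bool using (Bool; true; false)
open import Data.Nat using (ℕ; zero; suc; _≤_; _∸_; z≤n; s≤s)
open import Data.Nat.Properties using (suc-injective)
open import Data.List using (List; []; _∷_; _++_; length; map; concat)
open import Data.List.Properties using (++-assoc; ++-identityʳ; concat-++; length-map)
import Data.List.Relation.Unary.All as ListAll
open ListAll using ([]; _∷_)
open import Data.List.Relation.Unary.All.Properties using (map⁺; ++⁺)
open import Data.List.Relation.Binary.Permutation.Propositional
  using (_↭_; ↭-refl; ↭-prep; ↭-swap; ↭-trans; ↭-sym)
open import Data.List.Relation.Binary.Permutation.Propositional.Properties using (All-resp-↭; ↭-length)
open import Data.Vec using (Vec; []; _∷_)
open import Data.Vec.Relation.Unary.All using (All; []; _∷_)
open import Data.Product using (_×_; ∃-syntax; _,_)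
open import Data.Sum using (_⊎_; inj₁; inj₂)
open import Function using (_∘_)
open import Function.Bundles using (_⇔_; mk⇔)
open import Relation.Binary.PropositionalEquality
open ≡-Reasoning

-- The pair (b , c) stands for the block 0^{b+1} 1^{c+1}, so that blocks need no positivity proofs.
Block : Set
Block = ℕ × ℕ

block : Block → Word
block (b , c) = (false ^^ suc b) ++ (true ^^ suc c)

blockWord : List Block → ℕ → Word
blockWord [] d = false ^^ d
blockWord ((b , c) ∷ ps) d = (false ^^ suc b) ++ (true ^^ suc c) ++ blockWord ps d

canonical : ℕ → List Block → ℕ → Word
canonical a ps d = (true ^^ a) ++ blockWord ps d

canonical-form : ∀ w → ∃[ a ] ∃[ ps ] ∃[ d ] w ≡ canonical a ps d
canonical-form [] = 0 , [] , 0 , refl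
canonical-form (true ∷ w) with canonical-form w
... | a , ps , d , refl = suc a , ps , d , refl
canonical-form (false ∷ w) with canonical-form w
... | suc a , ps , d , refl = 0 , (0 , a) ∷ ps , d , refl
... | zero , [] , d , refl = 0 , [] , suc d , refl
... | zero , (b , c) ∷ ps , d , refl = 0 , (suc b , c) ∷ ps , d , refl

optRun : Bool → ℕ → List Word
optRun x zero = []
optRun x (suc n) = (x ^^ suc n) ∷ []

concat-optRun : ∀ x n → concat (optRun x n) ≡ x ^^ n
concat-optRun x zero = refl
concat-optRun x (suc n) = ++-identityʳ (x ^^ suc n)

data NotStartingWith1 : Word → Set where
  []  : NotStartingWith1 []
  0∷_ : ∀ v → NotStartingWith1 (false ∷ v)

blockWord-notStartingWith1 : ∀ ps d → NotStartingWith1 (blockWord ps d)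
blockWord-notStartingWith1 [] zero = []
blockWord-notStartingWith1 [] (suc d) = 0∷ _
blockWord-notStartingWith1 (_ ∷ _) d = 0∷ _

runs-∷ : ∀ x xs {r rs} → runsAux x xs ≡ (r , rs) → runs (x ∷ xs) ≡ r ∷ rs
runs-∷ x xs eq rewrite eq = refl

runsAux-0∷ : ∀ y ys {r rs} → runsAux y ys ≡ (r , rs) → runsAux false (y ∷ ys) ≡ (false ∷ r , rs)
runsAux-0∷ y ys eq rewrite eq = refl

runsAux-11 : ∀ ys {r rs} → runsAux true ys ≡ (r , rs) → runsAux true (true ∷ ys) ≡ (true ∷ r , rs)
runsAux-11 ys eq rewrite eq = refl

runsAux-10 : ∀ ys → runsAux true (false ∷ ys) ≡ (true ∷ [] , runs (false ∷ ys))
runsAux-10 ys with runsAux false ys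
... | _ = refl

runsAux-0s : ∀ b y ys {r rs} → runsAux y ys ≡ (r , rs) →
  runsAux false ((false ^^ b) ++ y ∷ ys) ≡ (false ∷ (false ^^ b) ++ r , rs)
runsAux-0s zero y ys eq = runsAux-0∷ y ys eq
runsAux-0s (suc b) y ys eq = runsAux-0∷ false ((false ^^ b) ++ y ∷ ys) (runsAux-0s b y ys eq)

runsAux-zeros : ∀ d → runsAux false (false ^^ d) ≡ (false ∷ (false ^^ d) , [])
runsAux-zeros zero = refl
runsAux-zeros (suc d) = runsAux-0∷ false (false ^^ d) (runsAux-zeros d)

runsAux-1s : ∀ c {v} → NotStartingWith1 v → runsAux true ((true ^^ c) ++ v) ≡ (true ∷ (true ^^ c) , runs v)
runsAux-1s zero [] = refl
runsAux-1s zero (0∷ v) = runsAux-10 v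
runsAux-1s (suc c) low = runsAux-11 ((true ^^ c) ++ _) (runsAux-1s c low)

runs-blockWord : ∀ ps d → runs (blockWord ps d) ≡ map block ps ++ optRun false d
runs-blockWord [] zero = refl
runs-blockWord [] (suc d) = runs-∷ false (false ^^ d) (runsAux-zeros d)
runs-blockWord ((b , c) ∷ ps) d = begin
  runs (blockWord ((b , c) ∷ ps) d)
    ≡⟨ runs-∷ false ((false ^^ b) ++ (true ^^ suc c) ++ blockWord ps d)
         (runsAux-0s b true ((true ^^ c) ++ blockWord ps d) (runsAux-1s c (blockWord-notStartingWith1 ps d))) ⟩
  block (b , c) ∷ runs (blockWord ps d)
    ≡⟨ cong (block (b , c) ∷_) (runs-blockWord ps d) ⟩
  block (b , c) ∷ map block ps ++ optRun false d ∎

runs-canonical : ∀ a ps d → runs (canonical a ps d) ≡ optRun true a ++ map block ps ++ optRun false d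
runs-canonical zero ps d = runs-blockWord ps d
runs-canonical (suc a) ps d = begin
  runs (canonical (suc a) ps d)
    ≡⟨ runs-∷ true ((true ^^ a) ++ blockWord ps d) (runsAux-1s a (blockWord-notStartingWith1 ps d)) ⟩
  (true ^^ suc a) ∷ runs (blockWord ps d)
    ≡⟨ cong ((true ^^ suc a) ∷_) (runs-blockWord ps d) ⟩
  (true ^^ suc a) ∷ map block ps ++ optRun false d ∎

insertLex-↭ : ∀ u vs → insertLex u vs ↭ u ∷ vs
insertLex-↭ u [] = ↭-refl
insertLex-↭ u (v ∷ vs) with lexLeq u v
... | true = ↭-refl
... | false = ↭-trans (↭-prep v (insertLex-↭ u vs)) (↭-swap v u ↭-refl)

sortLex-↭ : ∀ us → sortLex us ↭ us
sortLex-↭ [] = ↭-refl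
sortLex-↭ (u ∷ us) = ↭-trans (insertLex-↭ u (sortLex us)) (↭-prep u (sortLex-↭ us))

_>ˡ_ : Word → Word → Set
u >ˡ v = lexLeq u v ≡ false

insertLex-max : ∀ u vs → ListAll.All (u >ˡ_) vs → insertLex u vs ≡ vs ++ u ∷ []
insertLex-max u [] [] = refl
insertLex-max u (v ∷ vs) (u>v ∷ u>vs) rewrite u>v = cong (v ∷_) (insertLex-max u vs u>vs)

sortLex-++-min : ∀ us v → ListAll.All (_>ˡ v) us → sortLex (us ++ v ∷ []) ≡ v ∷ sortLex us
sortLex-++-min [] v [] = refl
sortLex-++-min (u ∷ us) v (u>v ∷ us>v) rewrite sortLex-++-min us v us>v | u>v = refl

IsBlock : Word → Set
IsBlock u = ∃[ p ] u ≡ block p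

0s1->ˡ-zeros : ∀ b x d → ((false ^^ b) ++ true ∷ x) >ˡ (false ^^ d)
0s1->ˡ-zeros zero x zero = refl
0s1->ˡ-zeros zero x (suc d) = refl
0s1->ˡ-zeros (suc b) x zero = refl
0s1->ˡ-zeros (suc b) x (suc d) = 0s1->ˡ-zeros b x d

block->ˡ-zeros : ∀ d {u} → IsBlock u → u >ˡ (false ^^ d)
block->ˡ-zeros d ((b , c) , refl) = 0s1->ˡ-zeros (suc b) (true ^^ c) d

ones->ˡ-block : ∀ a {u} → IsBlock u → (true ^^ suc a) >ˡ u
ones->ˡ-block a ((b , c) , refl) = refl

sortLex-blocks-isBlock : ∀ ps → ListAll.All IsBlock (sortLex (map block ps))
sortLex-blocks-isBlock ps =
  All-resp-↭ (↭-sym (sortLex-↭ (map block ps))) (map⁺ (ListAll.universal (λ p → p , refl) ps))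

sortLex-blocks-++-zeros : ∀ ps d →
  sortLex (map block ps ++ optRun false d) ≡ optRun false d ++ sortLex (map block ps)
sortLex-blocks-++-zeros ps zero = cong sortLex (++-identityʳ (map block ps))
sortLex-blocks-++-zeros ps (suc d) =
  sortLex-++-min (map block ps) (false ^^ suc d)
    (map⁺ (ListAll.universal (λ p → block->ˡ-zeros (suc d) (p , refl)) ps))

ones->ˡ-zeros : ∀ a d → ListAll.All ((true ^^ suc a) >ˡ_) (optRun false d)
ones->ˡ-zeros a zero = []
ones->ˡ-zeros a (suc d) = refl ∷ []

sortLex-runs-canonical : ∀ a ps d →
  sortLex (runs (canonical a ps d)) ≡ optRun false d ++ sortLex (map block ps) ++ optRun true a
sortLex-runs-canonical zero ps d = begin
  sortLex (runs (canonical zero ps d))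
    ≡⟨ cong sortLex (runs-canonical zero ps d) ⟩
  sortLex (map block ps ++ optRun false d)
    ≡⟨ sortLex-blocks-++-zeros ps d ⟩
  optRun false d ++ sortLex (map block ps)
    ≡⟨ cong (optRun false d ++_) (++-identityʳ (sortLex (map block ps))) ⟨
  optRun false d ++ sortLex (map block ps) ++ [] ∎
sortLex-runs-canonical (suc a) ps d = begin
  sortLex (runs (canonical (suc a) ps d))
    ≡⟨ cong sortLex (runs-canonical (suc a) ps d) ⟩
  insertLex (true ^^ suc a) (sortLex (map block ps ++ optRun false d))
    ≡⟨ cong (insertLex (true ^^ suc a)) (sortLex-blocks-++-zeros ps d) ⟩
  insertLex (true ^^ suc a) (optRun false d ++ sortLex (map block ps))
    ≡⟨ insertLex-max (true ^^ suc a) _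
         (++⁺ (ones->ˡ-zeros a d) (ListAll.map (ones->ˡ-block a) (sortLex-blocks-isBlock ps))) ⟩
  (optRun false d ++ sortLex (map block ps)) ++ optRun true (suc a)
    ≡⟨ ++-assoc (optRun false d) (sortLex (map block ps)) _ ⟩
  optRun false d ++ sortLex (map block ps) ++ optRun true (suc a) ∎

des-0∷ : ∀ w → des (false ∷ w) ≡ des w
des-0∷ [] = refl
des-0∷ (_ ∷ _) = refl

des-0s-++ : ∀ d w → des ((false ^^ d) ++ w) ≡ des w
des-0s-++ zero w = refl
des-0s-++ (suc d) w = trans (des-0∷ ((false ^^ d) ++ w)) (des-0s-++ d w)

des-1∷1s : ∀ a → des (true ∷ (true ^^ a)) ≡ 0
des-1∷1s zero = refl
des-1∷1s (suc a) = des-1∷1s a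

des-1∷1s-++-1s : ∀ c a → des (true ∷ (true ^^ c) ++ (true ^^ a)) ≡ 0
des-1∷1s-++-1s zero a = des-1∷1s a
des-1∷1s-++-1s (suc c) a = des-1∷1s-++-1s c a

des-1∷1s-++-0∷ : ∀ c w → des (true ∷ (true ^^ c) ++ false ∷ w) ≡ suc (des (false ∷ w))
des-1∷1s-++-0∷ zero w = refl
des-1∷1s-++-0∷ (suc c) w = des-1∷1s-++-0∷ c w

des-block-++ : ∀ b c w → des (block (b , c) ++ w) ≡ des (true ∷ (true ^^ c) ++ w)
des-block-++ b c w = trans (cong des (++-assoc (false ^^ suc b) (true ^^ suc c) w)) (des-0s-++ (suc b) _)

des-1∷1s-++-blocks-++-1s : ∀ c us a → ListAll.All IsBlock us →
  des (true ∷ (true ^^ c) ++ concat us ++ (true ^^ a)) ≡ length us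
des-1∷1s-++-blocks-++-1s c [] a [] = des-1∷1s-++-1s c a
des-1∷1s-++-blocks-++-1s c (.(block (b , c′)) ∷ us) a (((b , c′) , refl) ∷ areBlocks) = begin
  des (true ∷ (true ^^ c) ++ (block (b , c′) ++ concat us) ++ (true ^^ a))
    ≡⟨ des-1∷1s-++-0∷ c _ ⟩
  suc (des ((block (b , c′) ++ concat us) ++ (true ^^ a)))
    ≡⟨ cong (suc ∘ des) (++-assoc (block (b , c′)) (concat us) _) ⟩
  suc (des (block (b , c′) ++ concat us ++ (true ^^ a)))
    ≡⟨ cong suc (des-block-++ b c′ _) ⟩
  suc (des (true ∷ (true ^^ c′) ++ concat us ++ (true ^^ a)))
    ≡⟨ cong suc (des-1∷1s-++-blocks-++-1s c′ us a areBlocks) ⟩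
  suc (length us) ∎

des-blocks-++-1s : ∀ us a → ListAll.All IsBlock us → des (concat us ++ (true ^^ a)) ≡ length us ∸ 1
des-blocks-++-1s [] zero [] = refl
des-blocks-++-1s [] (suc a) [] = des-1∷1s a
des-blocks-++-1s (.(block (b , c)) ∷ us) a (((b , c) , refl) ∷ areBlocks) = begin
  des ((block (b , c) ++ concat us) ++ (true ^^ a))
    ≡⟨ cong des (++-assoc (block (b , c)) (concat us) _) ⟩
  des (block (b , c) ++ concat us ++ (true ^^ a))
    ≡⟨ des-block-++ b c _ ⟩
  des (true ∷ (true ^^ c) ++ concat us ++ (true ^^ a))
    ≡⟨ des-1∷1s-++-blocks-++-1s c us a areBlocks ⟩
  length us ∎

des-runsort-canonical : ∀ a ps d → des (runsort (canonical a ps d)) ≡ length ps ∸ 1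
des-runsort-canonical a ps d = begin
  des (runsort (canonical a ps d))
    ≡⟨ cong (des ∘ concat) (sortLex-runs-canonical a ps d) ⟩
  des (concat (optRun false d ++ sorted-blocks ++ optRun true a))
    ≡⟨ cong des (concat-++ (optRun false d) _) ⟨
  des (concat (optRun false d) ++ concat (sorted-blocks ++ optRun true a))
    ≡⟨ cong des (cong₂ _++_ (concat-optRun false d) (sym (concat-++ sorted-blocks _))) ⟩
  des ((false ^^ d) ++ concat sorted-blocks ++ concat (optRun true a))
    ≡⟨ cong (λ ones → des ((false ^^ d) ++ concat sorted-blocks ++ ones)) (concat-optRun true a) ⟩
  des ((false ^^ d) ++ concat sorted-blocks ++ (true ^^ a))
    ≡⟨ des-0s-++ d _ ⟩
  des (concat sorted-blocks ++ (true ^^ a))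
    ≡⟨ des-blocks-++-1s sorted-blocks a (sortLex-blocks-isBlock ps) ⟩
  length sorted-blocks ∸ 1
    ≡⟨ cong (_∸ 1) (trans (↭-length (sortLex-↭ (map block ps))) (length-map block ps)) ⟩
  length ps ∸ 1 ∎
  where
  sorted-blocks = sortLex (map block ps)

blocks-∷-++ : ∀ {k} b c (bs cs : Vec ℕ k) d →
  blocks (b ∷ bs) (c ∷ cs) ++ (false ^^ d) ≡ (false ^^ b) ++ (true ^^ c) ++ blocks bs cs ++ (false ^^ d)
blocks-∷-++ b c bs cs d = begin
  ((false ^^ b) ++ (true ^^ c) ++ blocks bs cs) ++ (false ^^ d)
    ≡⟨ ++-assoc (false ^^ b) _ (false ^^ d) ⟩
  (false ^^ b) ++ ((true ^^ c) ++ blocks bs cs) ++ (false ^^ d)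
    ≡⟨ cong ((false ^^ b) ++_) (++-assoc (true ^^ c) (blocks bs cs) (false ^^ d)) ⟩
  (false ^^ b) ++ (true ^^ c) ++ blocks bs cs ++ (false ^^ d) ∎

blocks-as-blockWord : ∀ {k} {bs cs : Vec ℕ k} → All (1 ≤_) bs → All (1 ≤_) cs →
  ∃[ ps ] (length ps ≡ k × ∀ d → blocks bs cs ++ (false ^^ d) ≡ blockWord ps d)
blocks-as-blockWord [] [] = [] , refl , λ d → refl
blocks-as-blockWord {bs = suc b ∷ bs} {suc c ∷ cs} (s≤s z≤n ∷ bs≥1) (s≤s z≤n ∷ cs≥1)
  with blocks-as-blockWord bs≥1 cs≥1
... | ps , length-ps , eq =
  (b , c) ∷ ps , cong suc length-ps ,
  λ d → trans (blocks-∷-++ (suc b) (suc c) bs cs d)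
              (cong (λ rest → (false ^^ suc b) ++ (true ^^ suc c) ++ rest) (eq d))

blockWord-as-blocks : ∀ k ps → length ps ≡ k →
  ∃[ bs ] ∃[ cs ] (All (1 ≤_) {k} bs × All (1 ≤_) cs × ∀ d → blockWord ps d ≡ blocks bs cs ++ (false ^^ d))
blockWord-as-blocks zero [] refl = [] , [] , [] , [] , λ d → refl
blockWord-as-blocks (suc k) ((b , c) ∷ ps) length-ps
  with blockWord-as-blocks k ps (suc-injective length-ps)
... | bs , cs , bs≥1 , cs≥1 , eq =
  suc b ∷ bs , suc c ∷ cs , s≤s z≤n ∷ bs≥1 , s≤s z≤n ∷ cs≥1 ,
  λ d → trans (cong (λ rest → (false ^^ suc b) ++ (true ^^ suc c) ++ rest) (eq d))
              (sym (blocks-∷-++ (suc b) (suc c) bs cs d))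

∸1-injective : ∀ {m k} → 2 ≤ k → m ∸ 1 ≡ k ∸ 1 → m ≡ k
∸1-injective {zero} (s≤s (s≤s _)) ()
∸1-injective {suc m} (s≤s (s≤s _)) eq = cong suc eq

AtMostOneBlock : Word → Set
AtMostOneBlock w =
  (∃[ a ] ∃[ d ] (w ≡ (true ^^ a) ++ (false ^^ d)))
  ⊎ (∃[ a ] ∃[ b ] ∃[ c ] ∃[ d ] (1 ≤ b × 1 ≤ c × w ≡ (true ^^ a) ++ (false ^^ b) ++ (true ^^ c) ++ (false ^^ d)))

HasBlocks : ℕ → Word → Set
HasBlocks k w =
  ∃[ a ] ∃[ d ] ∃[ bs ] ∃[ cs ]
    (All (1 ≤_) {k} bs × All (1 ≤_) {k} cs × w ≡ (true ^^ a) ++ blocks bs cs ++ (false ^^ d))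

des-runsort≡0⇒atMostOneBlock : ∀ w → des (runsort w) ≡ 0 → AtMostOneBlock w
des-runsort≡0⇒atMostOneBlock w des≡0 with canonical-form w
... | a , ps , d , refl with ps | trans (sym (des-runsort-canonical a ps d)) des≡0
...   | [] | _ = inj₁ (a , d , refl)
...   | (b , c) ∷ [] | _ = inj₂ (a , suc b , suc c , d , s≤s z≤n , s≤s z≤n , refl)
...   | _ ∷ _ ∷ _ | ()

atMostOneBlock⇒des-runsort≡0 : ∀ w → AtMostOneBlock w → des (runsort w) ≡ 0
atMostOneBlock⇒des-runsort≡0 _ (inj₁ (a , d , refl)) = des-runsort-canonical a [] d
atMostOneBlock⇒des-runsort≡0 _ (inj₂ (a , suc b , suc c , d , _ , _ , refl)) =
  des-runsort-canonical a ((b , c) ∷ []) d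

des-runsort≡pred⇒hasBlocks : ∀ k w → 2 ≤ k → des (runsort w) ≡ k ∸ 1 → HasBlocks k w
des-runsort≡pred⇒hasBlocks k w k≥2 des≡k-1 with canonical-form w
... | a , ps , d , refl
  with blockWord-as-blocks k ps (∸1-injective k≥2 (trans (sym (des-runsort-canonical a ps d)) des≡k-1))
... | bs , cs , bs≥1 , cs≥1 , eq = a , d , bs , cs , bs≥1 , cs≥1 , cong ((true ^^ a) ++_) (eq d)

hasBlocks⇒des-runsort≡pred : ∀ k w → HasBlocks k w → des (runsort w) ≡ k ∸ 1
hasBlocks⇒des-runsort≡pred k _ (a , d , bs , cs , bs≥1 , cs≥1 , refl) with blocks-as-blockWord bs≥1 cs≥1
... | ps , refl , eq =
  trans (cong (λ rest → des (runsort ((true ^^ a) ++ rest))) (eq d)) (des-runsort-canonical a ps d)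

proposition5p9 : (n : ℕ) → 1 ≤ n →
    ((w : Word) → length w ≡ n →
      (des (runsort w) ≡ 0 ⇔
        ((∃[ a ] ∃[ d ] (w ≡ (true ^^ a) ++ (false ^^ d)))
         ⊎ (∃[ a ] ∃[ b ] ∃[ c ] ∃[ d ]
              (1 ≤ b × 1 ≤ c × w ≡ (true ^^ a) ++ (false ^^ b) ++ (true ^^ c) ++ (false ^^ d))))))
    × ((k : ℕ) → 2 ≤ k → (w : Word) → length w ≡ n →
      (des (runsort w) ≡ k ∸ 1 ⇔
        (∃[ a ] ∃[ d ] ∃[ bs ] ∃[ cs ]
          (All (1 ≤_) {k} bs × All (1 ≤_) {k} cs
           × w ≡ (true ^^ a) ++ blocks bs cs ++ (false ^^ d)))))
proposition5p9 _ _ =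
  (λ w _ → mk⇔ (des-runsort≡0⇒atMostOneBlock w) (atMostOneBlock⇒des-runsort≡0 w)) ,
  (λ k k≥2 w _ → mk⇔ (des-runsort≡pred⇒hasBlocks k w k≥2) (hasBlocks⇒des-runsort≡pred k w))
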